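{- Let $m>n$ be positive integers. There is a map $\Phi:\mathcal{D}_{m,n}\to\mathcal{D}_{m,n}$ such that for every $P\in\mathcal{D}_{m,n}$: $\Phi(\Phi(P))=P$, $\mathrm{comp}(\Phi(P))=\mathrm{comp}(P)$, $\mathrm{run}(\Phi(P))=\mathrm{ret}(P)$ and $\mathrm{ret}(\Phi(P))=\mathrm{run}(P)$.
   Context: An $m\times n$ rational Dyck path is a lattice path from $(0,0)$ to $(m,n)$ using unit north steps $N=(0,1)$ and east steps $E=(1,0)$ that stays weakly above the line $y=nx/m$; $\mathcal{D}_{m,n}$ denotes the set of these paths. For $P\in\mathcal{D}_{m,n}$, its coarea sequence is $(u_1,\dots,u_n)$, where $u_i$ is the $x$-coordinate of the $i$-th north step of $P$ (counted from bottom to top), i.e. the number of cells of the $m\times n$ rectangle to the left of that step. The run statistic is $\mathrm{run}(P)=\min\{i\in\{1,\dots,n\}: i\notin\{u_1,\dots,u_n\}\}$. The rank of a lattice point $(i,j)$ is $jm-in$. The return statistic $\mathrm{ret}(P)$ is the number of north steps of $P$ from some $(i,j)$ to $(i,j+1)$ with $jm-in<n$ (equivalently, the number of north steps lying on the boundary of a cell of the rectangle whose interior meets the line $y=nx/m$). The composition type $\mathrm{comp}(P)$ is the composition of $n$ formed by the lengths of the maximal blocks of consecutive north steps of $P$, read from start to end. -}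

module Defs where

open import Data.Nat using (ℕ; zero; suc; _+_; _*_; _≤_; _<_; _∸_; _<ᵇ_; _≡ᵇ_)
open import Data.Bool using (Bool; true; false; if_then_else_; _∧_; T)
open import Data.List using (List; []; _∷_)
open import Data.Product using (Σ; _×_; _,_; proj₁)
open import Relation.Binary.PropositionalEquality using (_≡_)

-- Lattice steps: N = (0,1), E = (1,0).
data Step : Set where
  N E : Step

#N : List Step → ℕ
#N []       = 0
#N (N ∷ s)  = suc (#N s)
#N (E ∷ s)  = #N s

#E : List Step → ℕ
#E []       = 0
#E (N ∷ s)  = #E s
#E (E ∷ s)  = suc (#E s)

-- Every lattice point (i,j) visited, starting from the current point (i,j),
-- satisfies i*n ≤ j*m  (weakly above the line y = n x / m).
aboveFrom : (m n i j : ℕ) → List Step → Set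
aboveFrom m n i j []       = i * n ≤ j * m
aboveFrom m n i j (N ∷ s)  = (i * n ≤ j * m) × aboveFrom m n i (suc j) s
aboveFrom m n i j (E ∷ s)  = (i * n ≤ j * m) × aboveFrom m n (suc i) j s

IsDyck : (m n : ℕ) → List Step → Set
IsDyck m n p = (#E p ≡ m) × (#N p ≡ n) × aboveFrom m n 0 0 p

Dyck : (m n : ℕ) → Set
Dyck m n = Σ (List Step) (IsDyck m n)

coareaFrom : ℕ → List Step → List ℕ
coareaFrom i []       = []
coareaFrom i (N ∷ s)  = i ∷ coareaFrom i s
coareaFrom i (E ∷ s)  = coareaFrom (suc i) s

coarea : List Step → List ℕ
coarea = coareaFrom 0

memℕ : ℕ → List ℕ → Bool
memℕ k []       = false
memℕ k (u ∷ us) = if k ≡ᵇ u then true else memℕ k us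

-- smallest i ∈ {k, k+1, …, k+fuel} not in us (returns k+fuel if none before)
firstMissing : ℕ → ℕ → List ℕ → ℕ
firstMissing k zero       us = k
firstMissing k (suc fuel) us =
  if memℕ k us then firstMissing (suc k) fuel us else k

-- run(P) = min { i ∈ {1,…,n} : i ∉ coarea(P) }, where n = number of north steps.
-- (For a Dyck path u₁ = 0, so some i ∈ {1,…,n} is missing and the search,
--  over {1,…,n}, always finds it.)
run : List Step → ℕ
run p = firstMissing 1 (#N p ∸ 1) (coarea p)

-- ret(P): number of north steps from (i,j) to (i,j+1) with rank j*m - i*n < n,
-- i.e. j*m < i*n + n.
retFrom : (m n i j : ℕ) → List Step → ℕ
retFrom m n i j []       = 0
retFrom m n i j (N ∷ s)  =
  (if j * m <ᵇ i * n + n then 1 else 0) + retFrom m n i (suc j) s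
retFrom m n i j (E ∷ s)  = retFrom m n (suc i) j s

ret : (m n : ℕ) → List Step → ℕ
ret m n = retFrom m n 0 0

-- comp(P): lengths of the maximal blocks of consecutive north steps, in order.
-- compAux c s : c = length of the current (unfinished) block of N's.
compAux : ℕ → List Step → List ℕ
compAux zero    []       = []
compAux (suc c) []       = suc c ∷ []
compAux c       (N ∷ s)  = compAux (suc c) s
compAux zero    (E ∷ s)  = compAux zero s
compAux (suc c) (E ∷ s)  = suc c ∷ compAux zero s

comp : List Step → List ℕ
comp = compAux 0

-- Cut a path into its maximal blocks of north steps: block k has length c_k, starts at height
-- s_k = c₀ + ⋯ + c_{k−1} and lies on the line x = x_k. For a fixed composition comp P = (c_k)
-- the path is determined by its offsets w_k = x_k − k, and the offset sequences that occur are
-- exactly the weakly increasing w with w_k ≤ a_k = ⌊s_k m/n⌋ − k (block k starts above y = nx/m).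
-- In these terms run P is the number of leading zeros of w; since m > n only the first step of a
-- block can be a return, so ret P is the number of touches w_k = a_k.
--
-- It remains to exchange leading zeros and touches among the sequences under a weakly increasing
-- bound A with a₀ = 0. Such a w is determined by its number z of leading zeros together with
-- lower w, a sequence under the smaller bound shift z A; it is equally determined by its number
-- t of touches together with dropTouches A w, a sequence under shift t A. Recursively trading the
-- first decomposition for the second gives zerosToTouches, and the converse touchesToZeros; they
-- are mutually inverse and swap the two statistics. Applying the first when there are fewer zeros
-- than touches, the second when there are more, and the identity otherwise gives the involution φ.

module Submission where

open import Defs
open import Algebra.Properties.CommutativeSemigroup using (x∙yz≈yx∙z)
open import Data.Bool using (true; false; if_then_else_)
open import Data.List using (List; []; _∷_; _++_; map; replicate; drop; length)
open import Data.List.Properties using (length-map; length-drop; map-id; map-∘)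
open import Data.List.Relation.Unary.All using (All; []; _∷_)
open import Data.Nat using (ℕ; zero; suc; pred; _+_; _*_; _∸_; _/_; _%_; _≤_; _<_; z≤n; s≤s; z<s; _≟_; _<?_; _<ᵇ_;
                            NonZero; >-nonZero; ≢-nonZero⁻¹; >-nonZero⁻¹)
open import Data.Nat.DivMod using (0/n≡0; m≡m%n+[m/n]*n; m%n<n; m*n/n≡m; /-monoˡ-≤; m/n*n≤m; m<n*o⇒m/o<n)
open import Data.Nat.ListAction using (sum)
open import Data.Nat.Properties
open import Data.Nat.Tactic.RingSolver using (solve-∀)
open import Data.Product using (Σ; _×_; _,_; proj₁; proj₂)
open import Function using (_∘_)
open import Relation.Binary.Definitions using (tri<; tri≈; tri>)
open import Relation.Binary.PropositionalEquality
open import Relation.Nullary using (yes; no; contradiction)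
open import Relation.Nullary.Decidable using (dec-true; dec-false)

-- Weakly increasing sequences under a bound

data Ascending : ℕ → List ℕ → Set where
  []  : ∀ {lo} → Ascending lo []
  _∷_ : ∀ {lo a A} → lo ≤ a → Ascending a A → Ascending lo (a ∷ A)

data Fits : ℕ → List ℕ → List ℕ → Set where
  []   : ∀ {lo} → Fits lo [] []
  cons : ∀ {lo a x A w} → lo ≤ x → x ≤ a → Fits x A w → Fits lo (a ∷ A) (x ∷ w)

zeros : List ℕ → ℕ
zeros []          = 0
zeros (zero ∷ w)  = suc (zeros w)
zeros (suc _ ∷ _) = 0

touches : List ℕ → List ℕ → ℕ
touches (a ∷ A) (x ∷ w) with x ≟ a
... | yes _ = suc (touches A w)
... | no  _ = touches A w
touches _ _ = 0

shift : ℕ → List ℕ → List ℕ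
shift k A = map pred (drop k A)

raise : ℕ → List ℕ → List ℕ
raise b v = replicate b 0 ++ map suc v

lower : List ℕ → List ℕ
lower []          = []
lower (zero ∷ w)  = lower w
lower (suc x ∷ w) = x ∷ map pred w

dropTouches : List ℕ → List ℕ → List ℕ
dropTouches (a ∷ A) (x ∷ w) with x ≟ a
... | yes _ = dropTouches A w
... | no  _ = x ∷ dropTouches A w
dropTouches _ _ = []

insertTouches : ℕ → List ℕ → List ℕ → List ℕ
insertTouches zero    A       v       = v
insertTouches (suc b) []      v       = []
insertTouches (suc b) (a ∷ A) []      = a ∷ insertTouches b A []
insertTouches (suc b) (a ∷ A) (x ∷ v) with x <? a
... | yes _ = x ∷ insertTouches (suc b) A v
... | no  _ = a ∷ insertTouches b A (x ∷ v)

module _ {a x : ℕ} {A w : List ℕ} where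

  touches-≡ : x ≡ a → touches (a ∷ A) (x ∷ w) ≡ suc (touches A w)
  touches-≡ x≡a with x ≟ a
  ... | yes _   = refl
  ... | no  x≢a = contradiction x≡a x≢a

  touches-≢ : x ≢ a → touches (a ∷ A) (x ∷ w) ≡ touches A w
  touches-≢ x≢a with x ≟ a
  ... | yes x≡a = contradiction x≡a x≢a
  ... | no  _   = refl

  dropTouches-≡ : x ≡ a → dropTouches (a ∷ A) (x ∷ w) ≡ dropTouches A w
  dropTouches-≡ x≡a with x ≟ a
  ... | yes _   = refl
  ... | no  x≢a = contradiction x≡a x≢a

  dropTouches-≢ : x ≢ a → dropTouches (a ∷ A) (x ∷ w) ≡ x ∷ dropTouches A w
  dropTouches-≢ x≢a with x ≟ a
  ... | yes x≡a = contradiction x≡a x≢a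
  ... | no  _   = refl

  insertTouches-< : ∀ b → x < a → insertTouches b (a ∷ A) (x ∷ w) ≡ x ∷ insertTouches b A w
  insertTouches-< zero    x<a = refl
  insertTouches-< (suc b) x<a with x <? a
  ... | yes _   = refl
  ... | no  x≮a = contradiction x<a x≮a

  insertTouches-≥ : ∀ b → a ≤ x → insertTouches (suc b) (a ∷ A) (x ∷ w) ≡ a ∷ insertTouches b A (x ∷ w)
  insertTouches-≥ b a≤x with x <? a
  ... | yes x<a = contradiction a≤x (<⇒≱ x<a)
  ... | no  _   = refl

asc-weaken : ∀ {lo lo′ A} → lo′ ≤ lo → Ascending lo A → Ascending lo′ A
asc-weaken _     []          = []
asc-weaken lo′≤lo (lo≤a ∷ asc) = ≤-trans lo′≤lo lo≤a ∷ asc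

asc-tail : ∀ {lo a A} → Ascending lo (a ∷ A) → Ascending lo A
asc-tail (lo≤a ∷ asc) = asc-weaken lo≤a asc

asc-positive : ∀ {lo a A} → Ascending lo (suc a ∷ A) → Ascending 1 (suc a ∷ A)
asc-positive (_ ∷ asc) = s≤s z≤n ∷ asc

asc-shift : ∀ k {A} → Ascending 1 A → Ascending 0 (shift k A)
asc-shift k asc = pred⁺ (drop⁺ k asc)
  where
  drop⁺ : ∀ {lo} k {A} → Ascending lo A → Ascending lo (drop k A)
  drop⁺ zero    asc = asc
  drop⁺ (suc k) []  = []
  drop⁺ (suc k) (lo≤a ∷ asc) = asc-weaken lo≤a (drop⁺ k asc)
  pred⁺ : ∀ {lo A} → Ascending lo A → Ascending (pred lo) (map pred A)
  pred⁺ []           = []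
  pred⁺ (lo≤a ∷ asc) = pred-mono-≤ lo≤a ∷ pred⁺ asc

fits-length : ∀ {lo A w} → Fits lo A w → length w ≡ length A
fits-length []           = refl
fits-length (cons _ _ f) = cong suc (fits-length f)

fits-weaken : ∀ {lo lo′ A w} → lo′ ≤ lo → Fits lo A w → Fits lo′ A w
fits-weaken _      []                = []
fits-weaken lo′≤lo (cons lo≤x x≤a f) = cons (≤-trans lo′≤lo lo≤x) x≤a f

fits-[] : ∀ {lo lo′ A} → Fits lo A [] → Fits lo′ A []
fits-[] [] = []

fits-head : ∀ {lo A x w} → Fits lo A (x ∷ w) → lo ≤ x
fits-head (cons lo≤x _ _) = lo≤x

fits-rebase : ∀ {lo lo′ A x w} → lo′ ≤ x → Fits lo A (x ∷ w) → Fits lo′ A (x ∷ w)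
fits-rebase lo′≤x (cons _ x≤a f) = cons lo′≤x x≤a f

fits-pred : ∀ {lo A w} → Fits lo A w → Fits (pred lo) (map pred A) (map pred w)
fits-pred []                = []
fits-pred (cons lo≤x x≤a f) = cons (pred-mono-≤ lo≤x) (pred-mono-≤ x≤a) (fits-pred f)

fits-unpred : ∀ {lo A w} → Fits lo (map pred A) w → Fits lo A w
fits-unpred {A = []}    []                = []
fits-unpred {A = a ∷ A} (cons lo≤x x≤a f) = cons lo≤x (≤-trans x≤a pred[n]≤n) (fits-unpred f)

fits-suc : ∀ {lo A v} → Ascending 1 A → Fits lo (map pred A) v → Fits (suc lo) A (map suc v)
fits-suc {A = []}        _          []                = []
fits-suc {A = suc a ∷ A} (_ ∷ asc) (cons lo≤x x≤a f) =
  cons (s≤s lo≤x) (s≤s x≤a) (fits-suc (asc-weaken (s≤s z≤n) asc) f)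

fits-shift-tail : ∀ {lo} b A {x v} → Fits lo (shift b A) (x ∷ v) → Fits x (shift (suc b) A) v
fits-shift-tail zero    (a ∷ A) (cons _ _ f) = f
fits-shift-tail (suc b) (a ∷ A) f            = fits-shift-tail b A f

fits-shift-cons : ∀ {lo x a A ys} t → Ascending a A → x < a → t ≤ length A → lo ≤ x →
                  Fits x (shift t A) ys → Fits lo (shift t (a ∷ A)) (x ∷ ys)
fits-shift-cons zero _ x<a _ lo≤x f = cons lo≤x (<⇒≤pred x<a) f
fits-shift-cons {A = a′ ∷ A} (suc t) (a≤a′ ∷ asc) x<a (s≤s t≤∣A∣) lo≤x f =
  fits-shift-cons t asc (<-≤-trans x<a a≤a′) t≤∣A∣ lo≤x f

shift-length : ∀ {lo} b A {v} → Fits lo (shift b A) v → b ≤ length A → b + length v ≡ length A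
shift-length b A {v} f b≤∣A∣ = begin
  b + length v               ≡⟨ cong (b +_) (fits-length f) ⟩
  b + length (shift b A)     ≡⟨ cong (b +_) (trans (length-map pred (drop b A)) (length-drop b A)) ⟩
  b + (length A ∸ b)         ≡⟨ m+[n∸m]≡n b≤∣A∣ ⟩
  length A                   ∎
  where open ≡-Reasoning

map-pred-suc : ∀ v → map pred (map suc v) ≡ v
map-pred-suc v = trans (sym (map-∘ v)) (map-id v)

map-suc-pred : ∀ {lo A w} → Fits (suc lo) A w → map suc (map pred w) ≡ w
map-suc-pred []                       = refl
map-suc-pred (cons {x = suc x} _ _ f) = cong (suc x ∷_) (map-suc-pred f)

zeros≤length : ∀ {lo A w} → Fits lo A w → zeros w ≤ length A
zeros≤length []                       = z≤n
zeros≤length (cons {x = zero}  _ _ f) = s≤s (zeros≤length f)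
zeros≤length (cons {x = suc _} _ _ f) = z≤n

touches≤length : ∀ A w → touches A w ≤ length A
touches≤length []      w       = z≤n
touches≤length (a ∷ A) []      = z≤n
touches≤length (a ∷ A) (x ∷ w) with x ≟ a
... | yes _ = s≤s (touches≤length A w)
... | no  _ = m≤n⇒m≤1+n (touches≤length A w)

touches-pred : ∀ {lo A w} → Fits (suc lo) A w → touches (map pred A) (map pred w) ≡ touches A w
touches-pred [] = refl
touches-pred (cons {a = suc a} {x = suc x} _ _ f) with x ≟ a
... | yes x≡a = sym (trans (touches-≡ (cong suc x≡a)) (cong suc (sym (touches-pred f))))
... | no  x≢a = sym (trans (touches-≢ (x≢a ∘ suc-injective)) (sym (touches-pred f)))

touches-suc : ∀ {A} v → Ascending 1 A → touches A (map suc v) ≡ touches (map pred A) v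
touches-suc {[]}        v       _         = refl
touches-suc {zero ∷ A}  _       (() ∷ _)
touches-suc {suc a ∷ A} []      _         = refl
touches-suc {suc a ∷ A} (x ∷ v) (_ ∷ asc) with x ≟ a
... | yes x≡a = trans (touches-≡ (cong suc x≡a)) (cong suc (touches-suc v (asc-weaken (s≤s z≤n) asc)))
... | no  x≢a = trans (touches-≢ (x≢a ∘ suc-injective)) (touches-suc v (asc-weaken (s≤s z≤n) asc))

zeros-positive : ∀ {x w} → 1 ≤ x → zeros (x ∷ w) ≡ 0
zeros-positive {suc _} _ = refl

raise-lower : ∀ {lo A w} → Fits lo A w → raise (zeros w) (lower w) ≡ w
raise-lower []                         = refl
raise-lower (cons {x = zero}  _ _ f)   = cong (0 ∷_) (raise-lower f)
raise-lower (cons {x = suc x} _ _ f)   = cong (suc x ∷_) (map-suc-pred f)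

zeros-raise : ∀ b v → zeros (raise b v) ≡ b
zeros-raise zero    []      = refl
zeros-raise zero    (x ∷ v) = refl
zeros-raise (suc b) v       = cong suc (zeros-raise b v)

lower-raise : ∀ b v → lower (raise b v) ≡ v
lower-raise zero    []      = refl
lower-raise zero    (x ∷ v) = cong (x ∷_) (map-pred-suc v)
lower-raise (suc b) v       = lower-raise b v

lower-fits : ∀ {lo A w} → Fits lo A w → Fits 0 (shift (zeros w) A) (lower w)
lower-fits []                       = []
lower-fits (cons {x = zero}  _ _ f)   = lower-fits f
lower-fits (cons {x = suc x} _ x≤a f) = cons z≤n (pred-mono-≤ x≤a) (fits-pred f)

raise-fits : ∀ {A} b {v} → Ascending 1 A → b ≤ length A → Fits 0 (shift b A) v → Fits 0 A (raise b v)
raise-fits         zero    asc _ f = fits-weaken z≤n (fits-suc asc f)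
raise-fits {a ∷ A} (suc b) asc (s≤s b≤∣A∣) f = cons z≤n z≤n (raise-fits b (asc-tail asc) b≤∣A∣ f)

touches-lower : ∀ {lo A w} → Ascending 1 A → Fits lo A w → touches A w ≡ touches (shift (zeros w) A) (lower w)
touches-lower asc          []                         = refl
touches-lower (1≤a ∷ asc) (cons {x = zero} _ _ f)     =
  trans (touches-≢ (<⇒≢ 1≤a)) (touches-lower (asc-weaken 1≤a asc) f)
touches-lower asc          f@(cons {x = suc x} _ _ _) = sym (touches-pred (fits-rebase (s≤s z≤n) f))

touches-raise : ∀ {A} b {v} → Ascending 1 A → b ≤ length A → touches A (raise b v) ≡ touches (shift b A) v
touches-raise         zero    {v} asc         _           = touches-suc v asc
touches-raise {a ∷ A} (suc b)     (1≤a ∷ asc) (s≤s b≤∣A∣) =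
  trans (touches-≢ (<⇒≢ 1≤a)) (touches-raise b (asc-weaken 1≤a asc) b≤∣A∣)

touches-under-pred : ∀ {lo A v} → Ascending 1 A → Fits lo (map pred A) v → touches A v ≡ 0
touches-under-pred {A = []}        _         []             = refl
touches-under-pred {A = zero ∷ A}  (() ∷ _)  _
touches-under-pred {A = suc a ∷ A} (_ ∷ asc) (cons _ x≤a f) =
  trans (touches-≢ (<⇒≢ (s≤s x≤a))) (touches-under-pred (asc-weaken (s≤s z≤n) asc) f)

dropTouches-under-pred : ∀ {lo A v} → Ascending 1 A → Fits lo (map pred A) v → dropTouches A v ≡ v
dropTouches-under-pred {A = []}        _         []                       = refl
dropTouches-under-pred {A = zero ∷ A}  (() ∷ _)  _
dropTouches-under-pred {A = suc a ∷ A} (_ ∷ asc) (cons {x = x} _ x≤a f) =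
  trans (dropTouches-≢ (<⇒≢ (s≤s x≤a))) (cong (x ∷_) (dropTouches-under-pred (asc-weaken (s≤s z≤n) asc) f))

dropTouches-fits : ∀ {l lo A w} → Ascending l A → Fits lo A w → Fits lo (shift (touches A w) A) (dropTouches A w)
dropTouches-fits _ [] = []
dropTouches-fits (_ ∷ asc) (cons {a = a} {x = x} {A = A} {w = w} lo≤x x≤a f) with x ≟ a
... | yes refl = fits-weaken lo≤x (dropTouches-fits asc f)
... | no  x≢a  =
  fits-shift-cons (touches A w) asc (≤∧≢⇒< x≤a x≢a) (touches≤length A w) lo≤x (dropTouches-fits asc f)

zeros-dropTouches : ∀ {lo A w} → Ascending 1 A → Fits lo A w → zeros (dropTouches A w) ≡ zeros w
zeros-dropTouches _ [] = refl
zeros-dropTouches (1≤a ∷ asc) (cons {x = zero} _ _ f) =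
  trans (cong zeros (dropTouches-≢ (<⇒≢ 1≤a))) (cong suc (zeros-dropTouches (asc-weaken 1≤a asc) f))
zeros-dropTouches _ f@(cons {x = suc _} _ _ _) = no-zeros (fits-rebase (s≤s z≤n) f)
  where
  no-zeros : ∀ {lo A w} → Fits (suc lo) A w → zeros (dropTouches A w) ≡ 0
  no-zeros [] = refl
  no-zeros (cons {x = zero} () _ _)
  no-zeros (cons {a = a} {x = suc x} _ _ f) with suc x ≟ a
  ... | yes _ = no-zeros f
  ... | no  _ = refl

insertTouches-head : ∀ {a L v} b A → Fits a L v → insertTouches (suc b) (a ∷ A) v ≡ a ∷ insertTouches b A v
insertTouches-head b A []               = refl
insertTouches-head b A (cons a≤x _ _) = insertTouches-≥ b a≤x

insertTouches-dropTouches : ∀ {l lo A w} → Ascending l A → Fits lo A w →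
                            insertTouches (touches A w) A (dropTouches A w) ≡ w
insertTouches-dropTouches _ [] = refl
insertTouches-dropTouches (_ ∷ asc) (cons {a = a} {x = x} {A = A} {w = w} _ x≤a f) with x ≟ a
... | yes refl = trans (insertTouches-head (touches A w) A (dropTouches-fits asc f))
                       (cong (x ∷_) (insertTouches-dropTouches asc f))
... | no  x≢a  = trans (insertTouches-< (touches A w) (≤∧≢⇒< x≤a x≢a))
                       (cong (x ∷_) (insertTouches-dropTouches asc f))

insertTouches-fits : ∀ {lo} b A {v} → Ascending lo A → Fits lo (shift b A) v → Fits lo A (insertTouches b A v)
insertTouches-fits zero    A       asc f = fits-unpred f
insertTouches-fits (suc b) []      _   _ = []
insertTouches-fits (suc b) (a ∷ A) {[]} (lo≤a ∷ asc) f = cons lo≤a ≤-refl (insertTouches-fits b A asc (fits-[] f))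
insertTouches-fits (suc b) (a ∷ A) {x ∷ v} (lo≤a ∷ asc) f with x <? a
... | yes x<a = cons (fits-head f) (<⇒≤ x<a)
                     (insertTouches-fits (suc b) A (asc-weaken (<⇒≤ x<a) asc) (fits-shift-tail b A f))
... | no  x≮a = cons lo≤a ≤-refl (insertTouches-fits b A asc (fits-rebase (≮⇒≥ x≮a) f))

touches-insertTouches : ∀ {lo} b A {v} → Ascending 1 A → b + length v ≡ length A → Fits lo (shift b A) v →
                        touches A (insertTouches b A v) ≡ b
touches-insertTouches zero    A       asc _ f = touches-under-pred asc f
touches-insertTouches (suc b) (a ∷ A) {[]} asc len f =
  trans (touches-≡ {a} {a} {A} refl) (cong suc (touches-insertTouches b A (asc-tail asc) (suc-injective len) f))
touches-insertTouches (suc b) (a ∷ A) {x ∷ v} asc len f with x <? a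
... | yes x<a = trans (touches-≢ (<⇒≢ x<a))
                      (touches-insertTouches (suc b) A (asc-tail asc) len′ (fits-shift-tail b A f))
  where
  len′ : suc b + length v ≡ length A
  len′ = trans (sym (+-suc b (length v))) (suc-injective len)
... | no  _   = trans (touches-≡ {a} {a} {A} refl) (cong suc (touches-insertTouches b A (asc-tail asc) (suc-injective len) f))

dropTouches-insertTouches : ∀ {lo} b A {v} → Ascending 1 A → Fits lo (shift b A) v →
                            dropTouches A (insertTouches b A v) ≡ v
dropTouches-insertTouches zero    A       asc f = dropTouches-under-pred asc f
dropTouches-insertTouches (suc b) []      _   [] = refl
dropTouches-insertTouches (suc b) (a ∷ A) {[]} asc f =
  trans (dropTouches-≡ {a} {a} {A} refl) (dropTouches-insertTouches b A (asc-tail asc) f)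
dropTouches-insertTouches (suc b) (a ∷ A) {x ∷ v} asc f with x <? a
... | yes x<a = trans (dropTouches-≢ (<⇒≢ x<a))
                      (cong (x ∷_) (dropTouches-insertTouches (suc b) A (asc-tail asc) (fits-shift-tail b A f)))
... | no  _   = trans (dropTouches-≡ {a} {a} {A} refl) (dropTouches-insertTouches b A (asc-tail asc) f)

zeros-insertTouches : ∀ {lo} b A {v} → Ascending 1 A → Fits lo (shift b A) v → zeros (insertTouches b A v) ≡ zeros v
zeros-insertTouches zero    A                _         _ = refl
zeros-insertTouches (suc b) []               _         [] = refl
zeros-insertTouches (suc b) (a ∷ A) {[]}     (1≤a ∷ _) _ = zeros-positive 1≤a
zeros-insertTouches (suc b) (a ∷ A) {x ∷ v}  (1≤a ∷ asc) f with x <? a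
... | yes _   = zeros-cons x (zeros-insertTouches (suc b) A (asc-weaken 1≤a asc) (fits-shift-tail b A f))
  where
  zeros-cons : ∀ x {u v} → zeros u ≡ zeros v → zeros (x ∷ u) ≡ zeros (x ∷ v)
  zeros-cons zero    = cong suc
  zeros-cons (suc _) = λ _ → refl
... | no  x≮a = trans (zeros-positive 1≤a) (sym (zeros-positive (≤-trans 1≤a (≮⇒≥ x≮a))))

-- Exchanging leading zeros and touches

weight : List ℕ → ℕ
weight A = sum (map suc A)

weight-pred : ∀ L → weight (map pred L) ≤ weight L
weight-pred []      = z≤n
weight-pred (x ∷ L) = +-mono-≤ (s≤s pred[n]≤n) (weight-pred L)

weight-drop : ∀ k L → weight (drop k L) ≤ weight L
weight-drop zero    L       = ≤-refl
weight-drop (suc k) []      = z≤n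
weight-drop (suc k) (x ∷ L) = ≤-trans (weight-drop k L) (m≤n+m _ (suc x))

weight-shift : ∀ k a A → weight (shift k (suc a ∷ A)) < weight (suc a ∷ A)
weight-shift zero    a A = s≤s (+-monoʳ-≤ (suc a) (weight-pred A))
weight-shift (suc k) a A = begin-strict
  weight (shift k A)  ≤⟨ weight-pred (drop k A) ⟩
  weight (drop k A)   ≤⟨ weight-drop k A ⟩
  weight A            <⟨ s≤s (m≤n+m (weight A) (suc a)) ⟩
  weight (suc a ∷ A)  ∎
  where open ≤-Reasoning

-- The fuel only guarantees termination (see weight-shift). When a₀ = 0 the entry w₀ = 0 is
-- at once a leading zero and a touch, and is kept.
zerosToTouches : ℕ → List ℕ → List ℕ → List ℕ
zerosToTouches zero    A            w = w
zerosToTouches (suc f) []           w = w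
zerosToTouches (suc f) (zero ∷ A)   w = 0 ∷ zerosToTouches f A (drop 1 w)
zerosToTouches (suc f) A@(suc _ ∷ _) w =
  insertTouches (zeros w) A (zerosToTouches f (shift (zeros w) A) (lower w))

touchesToZeros : ℕ → List ℕ → List ℕ → List ℕ
touchesToZeros zero    A            w = w
touchesToZeros (suc f) []           w = w
touchesToZeros (suc f) (zero ∷ A)   w = 0 ∷ touchesToZeros f A (drop 1 w)
touchesToZeros (suc f) A@(suc _ ∷ _) w =
  raise (touches A w) (touchesToZeros f (shift (touches A w) A) (dropTouches A w))

record Exchanges (A w u : List ℕ) : Set where
  field
    fits          : Fits 0 A u
    zeros≡touches : zeros u ≡ touches A w
    touches≡zeros : touches A u ≡ zeros w

zerosToTouches-exchanges : ∀ f A w → weight A < f → Ascending 0 A → Fits 0 A w →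
                           Exchanges A w (zerosToTouches f A w)
zerosToTouches-exchanges (suc f) [] [] _ _ [] = record { fits = [] ; zeros≡touches = refl ; touches≡zeros = refl }
zerosToTouches-exchanges (suc f) (zero ∷ A) (0 ∷ w) (s≤s wt<f) (_ ∷ asc) (cons _ z≤n fw) = record
  { fits          = cons z≤n z≤n fits
  ; zeros≡touches = cong suc zeros≡touches
  ; touches≡zeros = cong suc touches≡zeros
  }
  where open Exchanges (zerosToTouches-exchanges f A w wt<f asc fw)
zerosToTouches-exchanges (suc f) A@(suc a ∷ A′) w (s≤s wt<f) asc fw = record
  { fits          = insertTouches-fits z A asc fits
  ; zeros≡touches = begin
      zeros (insertTouches z A u)           ≡⟨ zeros-insertTouches z A asc₁ fits ⟩
      zeros u                               ≡⟨ zeros≡touches ⟩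
      touches (shift z A) (lower w)         ≡⟨ touches-lower asc₁ fw ⟨
      touches A w                           ∎
  ; touches≡zeros = touches-insertTouches z A asc₁ (shift-length z A fits (zeros≤length fw)) fits
  }
  where
  open ≡-Reasoning
  z : ℕ
  z = zeros w
  u : List ℕ
  u = zerosToTouches f (shift z A) (lower w)
  asc₁ : Ascending 1 A
  asc₁ = asc-positive asc
  open Exchanges (zerosToTouches-exchanges f (shift z A) (lower w)
                    (<-≤-trans (weight-shift z a A′) wt<f) (asc-shift z asc₁) (lower-fits fw))

touchesToZeros-exchanges : ∀ f A w → weight A < f → Ascending 0 A → Fits 0 A w →
                           Exchanges A w (touchesToZeros f A w)
touchesToZeros-exchanges (suc f) [] [] _ _ [] = record { fits = [] ; zeros≡touches = refl ; touches≡zeros = refl }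
touchesToZeros-exchanges (suc f) (zero ∷ A) (0 ∷ w) (s≤s wt<f) (_ ∷ asc) (cons _ z≤n fw) = record
  { fits          = cons z≤n z≤n fits
  ; zeros≡touches = cong suc zeros≡touches
  ; touches≡zeros = cong suc touches≡zeros
  }
  where open Exchanges (touchesToZeros-exchanges f A w wt<f asc fw)
touchesToZeros-exchanges (suc f) A@(suc a ∷ A′) w (s≤s wt<f) asc fw = record
  { fits          = raise-fits t asc₁ (touches≤length A w) fits
  ; zeros≡touches = zeros-raise t u
  ; touches≡zeros = begin
      touches A (raise t u)       ≡⟨ touches-raise t asc₁ (touches≤length A w) ⟩
      touches (shift t A) u       ≡⟨ touches≡zeros ⟩
      zeros (dropTouches A w)     ≡⟨ zeros-dropTouches asc₁ fw ⟩
      zeros w                     ∎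
  }
  where
  open ≡-Reasoning
  t : ℕ
  t = touches A w
  u : List ℕ
  u = touchesToZeros f (shift t A) (dropTouches A w)
  asc₁ : Ascending 1 A
  asc₁ = asc-positive asc
  open Exchanges (touchesToZeros-exchanges f (shift t A) (dropTouches A w)
                    (<-≤-trans (weight-shift t a A′) wt<f) (asc-shift t asc₁) (dropTouches-fits asc fw))

touchesToZeros-zerosToTouches : ∀ f A w → weight A < f → Ascending 0 A → Fits 0 A w →
                                touchesToZeros f A (zerosToTouches f A w) ≡ w
touchesToZeros-zerosToTouches (suc f) [] [] _ _ [] = refl
touchesToZeros-zerosToTouches (suc f) (zero ∷ A) (0 ∷ w) (s≤s wt<f) (_ ∷ asc) (cons _ z≤n fw) =
  cong (0 ∷_) (touchesToZeros-zerosToTouches f A w wt<f asc fw)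
touchesToZeros-zerosToTouches (suc f) A@(suc a ∷ A′) w (s≤s wt<f) asc fw = begin
  touchesToZeros (suc f) A (insertTouches z A u)
    ≡⟨ cong (λ t → raise t (touchesToZeros f (shift t A) (dropTouches A (insertTouches z A u))))
            (touches-insertTouches z A asc₁ (shift-length z A fits (zeros≤length fw)) fits) ⟩
  raise z (touchesToZeros f (shift z A) (dropTouches A (insertTouches z A u)))
    ≡⟨ cong (λ v → raise z (touchesToZeros f (shift z A) v)) (dropTouches-insertTouches z A asc₁ fits) ⟩
  raise z (touchesToZeros f (shift z A) u)
    ≡⟨ cong (raise z) (touchesToZeros-zerosToTouches f (shift z A) (lower w) wt′<f (asc-shift z asc₁) (lower-fits fw)) ⟩
  raise z (lower w)
    ≡⟨ raise-lower fw ⟩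
  w ∎
  where
  open ≡-Reasoning
  z : ℕ
  z = zeros w
  u : List ℕ
  u = zerosToTouches f (shift z A) (lower w)
  asc₁ : Ascending 1 A
  asc₁ = asc-positive asc
  wt′<f : weight (shift z A) < f
  wt′<f = <-≤-trans (weight-shift z a A′) wt<f
  open Exchanges (zerosToTouches-exchanges f (shift z A) (lower w) wt′<f (asc-shift z asc₁) (lower-fits fw))

zerosToTouches-touchesToZeros : ∀ f A w → weight A < f → Ascending 0 A → Fits 0 A w →
                                zerosToTouches f A (touchesToZeros f A w) ≡ w
zerosToTouches-touchesToZeros (suc f) [] [] _ _ [] = refl
zerosToTouches-touchesToZeros (suc f) (zero ∷ A) (0 ∷ w) (s≤s wt<f) (_ ∷ asc) (cons _ z≤n fw) =
  cong (0 ∷_) (zerosToTouches-touchesToZeros f A w wt<f asc fw)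
zerosToTouches-touchesToZeros (suc f) A@(suc a ∷ A′) w (s≤s wt<f) asc fw = begin
  zerosToTouches (suc f) A (raise t u)
    ≡⟨ cong (λ z → insertTouches z A (zerosToTouches f (shift z A) (lower (raise t u)))) (zeros-raise t u) ⟩
  insertTouches t A (zerosToTouches f (shift t A) (lower (raise t u)))
    ≡⟨ cong (λ v → insertTouches t A (zerosToTouches f (shift t A) v)) (lower-raise t u) ⟩
  insertTouches t A (zerosToTouches f (shift t A) u)
    ≡⟨ cong (insertTouches t A) (zerosToTouches-touchesToZeros f (shift t A) (dropTouches A w) wt′<f
                                   (asc-shift t asc₁) (dropTouches-fits asc fw)) ⟩
  insertTouches t A (dropTouches A w)
    ≡⟨ insertTouches-dropTouches asc fw ⟩
  w ∎
  where
  open ≡-Reasoning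
  t : ℕ
  t = touches A w
  u : List ℕ
  u = touchesToZeros f (shift t A) (dropTouches A w)
  asc₁ : Ascending 1 A
  asc₁ = asc-positive asc
  wt′<f : weight (shift t A) < f
  wt′<f = <-≤-trans (weight-shift t a A′) wt<f

φ : List ℕ → List ℕ → List ℕ
φ A w with <-cmp (zeros w) (touches A w)
... | tri< _ _ _ = zerosToTouches (suc (weight A)) A w
... | tri≈ _ _ _ = w
... | tri> _ _ _ = touchesToZeros (suc (weight A)) A w

module _ {A w : List ℕ} where

  φ-< : zeros w < touches A w → φ A w ≡ zerosToTouches (suc (weight A)) A w
  φ-< z<t with <-cmp (zeros w) (touches A w)
  ... | tri< _ _ _   = refl
  ... | tri≈ z≮t _ _ = contradiction z<t z≮t
  ... | tri> z≮t _ _ = contradiction z<t z≮t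

  φ-≡ : zeros w ≡ touches A w → φ A w ≡ w
  φ-≡ z≡t with <-cmp (zeros w) (touches A w)
  ... | tri< _ z≢t _ = contradiction z≡t z≢t
  ... | tri≈ _ _ _   = refl
  ... | tri> _ z≢t _ = contradiction z≡t z≢t

  φ-> : touches A w < zeros w → φ A w ≡ touchesToZeros (suc (weight A)) A w
  φ-> t<z with <-cmp (zeros w) (touches A w)
  ... | tri< _ _ t≮z = contradiction t<z t≮z
  ... | tri≈ _ _ t≮z = contradiction t<z t≮z
  ... | tri> _ _ _   = refl

φ-exchanges : ∀ {A w} → Ascending 0 A → Fits 0 A w → Exchanges A w (φ A w)
φ-exchanges {A} {w} asc fw with <-cmp (zeros w) (touches A w)
... | tri< _ _ _   = zerosToTouches-exchanges _ A w ≤-refl asc fw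
... | tri≈ _ z≡t _ = record { fits = fw ; zeros≡touches = z≡t ; touches≡zeros = sym z≡t }
... | tri> _ _ _   = touchesToZeros-exchanges _ A w ≤-refl asc fw

φ-involutive : ∀ {A w} → Ascending 0 A → Fits 0 A w → φ A (φ A w) ≡ w
φ-involutive {A} {w} asc fw with <-cmp (zeros w) (touches A w)
... | tri< z<t _ _ = trans (φ-> (subst₂ _<_ (sym touches≡zeros) (sym zeros≡touches) z<t))
                           (touchesToZeros-zerosToTouches _ A w ≤-refl asc fw)
  where open Exchanges (zerosToTouches-exchanges _ A w ≤-refl asc fw)
... | tri≈ _ z≡t _ = φ-≡ z≡t
... | tri> _ _ t<z = trans (φ-< (subst₂ _<_ (sym zeros≡touches) (sym touches≡zeros) t<z))
                           (zerosToTouches-touchesToZeros _ A w ≤-refl asc fw)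
  where open Exchanges (touchesToZeros-exchanges _ A w ≤-refl asc fw)

-- Dyck paths as compositions with offsets

module _ {n : ℕ} .{{_ : NonZero n}} where

  m*n≤o⇒m≤o/n : ∀ {m o} → m * n ≤ o → m ≤ o / n
  m*n≤o⇒m≤o/n {m} le = subst (_≤ _) (m*n/n≡m m n) (/-monoˡ-≤ n le)

  m≤o/n⇒m*n≤o : ∀ {m o} → m ≤ o / n → m * n ≤ o
  m≤o/n⇒m*n≤o {m} {o} le = ≤-trans (*-monoˡ-≤ n le) (m/n*n≤m o n)

  m<[m/n]*n+n : ∀ m → m < m / n * n + n
  m<[m/n]*n+n m = begin-strict
    m                   ≡⟨ m≡m%n+[m/n]*n m n ⟩
    m % n + m / n * n   <⟨ +-monoˡ-< (m / n * n) (m%n<n m n) ⟩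
    n + m / n * n       ≡⟨ +-comm n (m / n * n) ⟩
    m / n * n + n       ∎
    where open ≤-Reasoning

  m*n≤o<m*n+n⇒m≡o/n : ∀ {m o} → m * n ≤ o → o < m * n + n → m ≡ o / n
  m*n≤o<m*n+n⇒m≡o/n {m} {o} le lt =
    ≤-antisym (m*n≤o⇒m≤o/n le) (≤-pred (m<n*o⇒m/o<n (subst (o <_) (+-comm (m * n) n) lt)))

east : ℕ → List Step → List Step
east g p = replicate g E ++ p

north : ℕ → List Step → List Step
north c p = replicate c N ++ p

east-suc : ∀ g p → east (suc g) p ≡ east g (E ∷ p)
east-suc zero    p = refl
east-suc (suc g) p = cong (E ∷_) (east-suc g p)

north-suc : ∀ c p → north (suc c) p ≡ north c (N ∷ p)
north-suc zero    p = refl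
north-suc (suc c) p = cong (N ∷_) (north-suc c p)

-- In offsetsFrom t x c p, t blocks are finished, the current abscissa is x and, as in compAux,
-- c is the length of the current block.
offsetsFrom : ℕ → ℕ → ℕ → List Step → List ℕ
offsetsFrom t x c       (N ∷ p) = offsetsFrom t x (suc c) p
offsetsFrom t x zero    (E ∷ p) = offsetsFrom t (suc x) zero p
offsetsFrom t x (suc c) (E ∷ p) = x ∸ t ∷ offsetsFrom (suc t) (suc x) zero p
offsetsFrom t x zero    []      = []
offsetsFrom t x (suc c) []      = x ∸ t ∷ []

offsets : List Step → List ℕ
offsets = offsetsFrom 0 0 0

#N-east : ∀ g p → #N (east g p) ≡ #N p
#N-east zero    p = refl
#N-east (suc g) p = #N-east g p

#N-north : ∀ c p → #N (north c p) ≡ c + #N p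
#N-north zero    p = refl
#N-north (suc c) p = cong suc (#N-north c p)

#E-east : ∀ g p → #E (east g p) ≡ g + #E p
#E-east zero    p = refl
#E-east (suc g) p = cong suc (#E-east g p)

#E-north : ∀ c p → #E (north c p) ≡ #E p
#E-north zero    p = refl
#E-north (suc c) p = #E-north c p

coarea-east : ∀ g x p → coareaFrom x (east g p) ≡ coareaFrom (g + x) p
coarea-east zero    x p = refl
coarea-east (suc g) x p = trans (coarea-east g (suc x) p) (cong (λ x′ → coareaFrom x′ p) (+-suc g x))

coarea-north : ∀ c x p → coareaFrom x (north c p) ≡ replicate c x ++ coareaFrom x p
coarea-north zero    x p = refl
coarea-north (suc c) x p = cong (x ∷_) (coarea-north c x p)

comp-east : ∀ g p → compAux 0 (east g p) ≡ compAux 0 p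
comp-east zero    p = refl
comp-east (suc g) p = comp-east g p

comp-north : ∀ k c p → compAux c (north k p) ≡ compAux (c + k) p
comp-north zero    c       p = cong (λ c′ → compAux c′ p) (sym (+-identityʳ c))
comp-north (suc k) zero    p = comp-north k 1 p
comp-north (suc k) (suc c) p = trans (comp-north k (suc (suc c)) p) (cong (λ c′ → compAux (suc c′) p) (sym (+-suc c k)))

offsets-east : ∀ g t x p → offsetsFrom t x 0 (east g p) ≡ offsetsFrom t (g + x) 0 p
offsets-east zero    t x p = refl
offsets-east (suc g) t x p = trans (offsets-east g t (suc x) p) (cong (λ x′ → offsetsFrom t x′ 0 p) (+-suc g x))

offsets-north : ∀ k t x c p → offsetsFrom t x c (north k p) ≡ offsetsFrom t x (c + k) p
offsets-north zero    t x c p = cong (λ c′ → offsetsFrom t x c′ p) (sym (+-identityʳ c))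
offsets-north (suc k) t x c p = trans (offsets-north k t x (suc c) p) (cong (λ c′ → offsetsFrom t x c′ p) (sym (+-suc c k)))

compAux-positive : ∀ c p → All (0 <_) (compAux c p)
compAux-positive zero    []      = []
compAux-positive (suc c) []      = z<s ∷ []
compAux-positive zero    (N ∷ p) = compAux-positive 1 p
compAux-positive (suc c) (N ∷ p) = compAux-positive (suc (suc c)) p
compAux-positive zero    (E ∷ p) = compAux-positive 0 p
compAux-positive (suc c) (E ∷ p) = z<s ∷ compAux-positive 0 p

sum-compAux : ∀ c p → sum (compAux c p) ≡ c + #N p
sum-compAux zero    []      = refl
sum-compAux (suc c) []      = refl
sum-compAux zero    (N ∷ p) = sum-compAux 1 p
sum-compAux (suc c) (N ∷ p) = trans (sum-compAux (suc (suc c)) p) (cong suc (sym (+-suc c (#N p))))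
sum-compAux zero    (E ∷ p) = sum-compAux 0 p
sum-compAux (suc c) (E ∷ p) = cong (suc c +_) (sum-compAux 0 p)

memℕ-replicate-≡ : ∀ c v L → memℕ v (replicate (suc c) v ++ L) ≡ true
memℕ-replicate-≡ c v L = cong (λ b → if b then true else memℕ v (replicate c v ++ L)) (dec-true (v ≟ v) refl)

memℕ-replicate-≢ : ∀ c {k v} L → k ≢ v → memℕ k (replicate c v ++ L) ≡ memℕ k L
memℕ-replicate-≢ zero    L k≢v = refl
memℕ-replicate-≢ (suc c) {k} {v} L k≢v =
  trans (cong (λ b → if b then true else memℕ k (replicate c v ++ L)) (dec-false (k ≟ v) k≢v))
        (memℕ-replicate-≢ c L k≢v)

firstMissing-≡ : ∀ fuel {k r us} → k ≤ r → r ≤ k + fuel → (∀ {j} → k ≤ j → j < r → memℕ j us ≡ true) →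
                 memℕ r us ≡ false → firstMissing k fuel us ≡ r
firstMissing-≡ zero {k} k≤r r≤k _ _ = sym (≤-antisym (≤-trans r≤k (≤-reflexive (+-identityʳ k))) k≤r)
firstMissing-≡ (suc fuel) {k} {r} {us} k≤r r≤k+fuel present r∉us with k ≟ r
... | yes refl = cong (λ b → if b then firstMissing (suc k) fuel us else k) r∉us
... | no  k≢r  = trans (cong (λ b → if b then firstMissing (suc k) fuel us else k) (present ≤-refl k<r))
                       (firstMissing-≡ fuel k<r (≤-trans r≤k+fuel (≤-reflexive (+-suc k fuel)))
                          (λ k<j j<r → present (<⇒≤ k<j) j<r) r∉us)
  where
  k<r : k < r
  k<r = ≤∧≢⇒< k≤r k≢r

blockCoarea : ℕ → List ℕ → List ℕ → List ℕ
blockCoarea t (c ∷ cs) (w ∷ ws) = replicate c (w + t) ++ blockCoarea (suc t) cs ws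
blockCoarea t _        _        = []

length≤sum : ∀ {cs} → All (0 <_) cs → length cs ≤ sum cs
length≤sum []               = z≤n
length≤sum (1≤c ∷ positive) = +-mono-≤ 1≤c (length≤sum positive)

∸-+-cancel : ∀ {y w} t → y ≤ w → (w ∸ y) + (y + t) ≡ w + t
∸-+-cancel {y} {w} t y≤w = trans (sym (+-assoc (w ∸ y) y t)) (cong (_+ t) (m∸n+n≡m y≤w))

module _ (m n : ℕ) where

  aboveFrom-head : ∀ {i j} p → aboveFrom m n i j p → i * n ≤ j * m
  aboveFrom-head []      ij      = ij
  aboveFrom-head (N ∷ p) (ij , _) = ij
  aboveFrom-head (E ∷ p) (ij , _) = ij

  above-east : ∀ g {x X j} p → g + x ≡ X → X * n ≤ j * m → aboveFrom m n X j p → aboveFrom m n x j (east g p)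
  above-east zero        p refl _  ab = ab
  above-east (suc g) {x} p g+x≡X Xj ab =
    ≤-trans (*-monoˡ-≤ n (subst (x ≤_) g+x≡X (m≤n+m x (suc g)))) Xj , above-east g p (trans (+-suc g x) g+x≡X) Xj ab

  above-north : ∀ c {x j} p → x * n ≤ j * m → aboveFrom m n x (c + j) p → aboveFrom m n x j (north c p)
  above-north zero            p _  ab = ab
  above-north (suc c) {x} {j} p xj ab =
    xj , above-north c p (≤-trans xj (m≤n+m (j * m) m)) (subst (λ j′ → aboveFrom m n x j′ p) (sym (+-suc c j)) ab)

  retFrom-east : ∀ g x j p → retFrom m n x j (east g p) ≡ retFrom m n (g + x) j p
  retFrom-east zero    x j p = refl
  retFrom-east (suc g) x j p = trans (retFrom-east g (suc x) j p) (cong (λ x′ → retFrom m n x′ j p) (+-suc g x))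

  retFrom-north : ∀ c x j p → x * n + n < j * m → retFrom m n x j (north c p) ≡ retFrom m n x (c + j) p
  retFrom-north zero    x j p _  = refl
  retFrom-north (suc c) x j p lt = begin
    (if j * m <ᵇ x * n + n then 1 else 0) + retFrom m n x (suc j) (north c p)
      ≡⟨ cong (λ b → (if b then 1 else 0) + retFrom m n x (suc j) (north c p))
              (dec-false (j * m <? x * n + n) (<-asym lt)) ⟩
    retFrom m n x (suc j) (north c p)
      ≡⟨ retFrom-north c x (suc j) p (<-≤-trans lt (m≤n+m (j * m) m)) ⟩
    retFrom m n x (c + suc j) p
      ≡⟨ cong (λ j′ → retFrom m n x j′ p) (+-suc c j) ⟩
    retFrom m n x (suc c + j) p ∎
    where open ≡-Reasoning

  -- In decodeFrom y t, y is the offset of the previous block and t the number of blocks written.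
  decodeFrom : ℕ → ℕ → List ℕ → List ℕ → List Step
  decodeFrom y t (c ∷ cs) (w ∷ ws) = east (w ∸ y) (north c (E ∷ decodeFrom w (suc t) cs ws))
  decodeFrom y t _        _        = east (m ∸ (y + t)) []

  decode : List ℕ → List ℕ → List Step
  decode = decodeFrom 0 0

  module Coding .{{_ : NonZero n}} (n<m : n < m) where

    bound : ℕ → ℕ → ℕ
    bound s t = s * m / n ∸ t

    bounds : ℕ → ℕ → List ℕ → List ℕ
    bounds s t []       = []
    bounds s t (c ∷ cs) = bound s t ∷ bounds (c + s) (suc t) cs

    length-bounds : ∀ s t cs → length (bounds s t cs) ≡ length cs
    length-bounds s t []       = refl
    length-bounds s t (c ∷ cs) = cong suc (length-bounds (c + s) (suc t) cs)

    s*m<m*n : ∀ {s} → s < n → s * m < m * n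
    s*m<m*n {s} s<n = subst (s * m <_) (*-comm n m) (*-monoˡ-< m {{>-nonZero (≤-<-trans z≤n n<m)}} s<n)

    s≤s*m/n : ∀ s → s ≤ s * m / n
    s≤s*m/n s = m*n≤o⇒m≤o/n (*-monoʳ-≤ s (<⇒≤ n<m))

    ≤bound⇒above : ∀ {w t s} → t ≤ s → w ≤ bound s t → (w + t) * n ≤ s * m
    ≤bound⇒above {w} {t} {s} t≤s w≤b = m≤o/n⇒m*n≤o (m≤o∸n⇒m+n≤o w (≤-trans t≤s (s≤s*m/n s)) w≤b)

    above⇒≤bound : ∀ {w t s} → (w + t) * n ≤ s * m → w ≤ bound s t
    above⇒≤bound {w} le = m+n≤o⇒m≤o∸n w (m*n≤o⇒m≤o/n le)

    ≡bound⇒rank<n : ∀ {w t s} → t ≤ s → w ≡ bound s t → s * m < (w + t) * n + n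
    ≡bound⇒rank<n {t = t} {s} t≤s refl =
      subst (λ x → s * m < x * n + n) (sym (m∸n+n≡m (≤-trans t≤s (s≤s*m/n s)))) (m<[m/n]*n+n (s * m))

    rank<n⇒≡bound : ∀ {w t s} → (w + t) * n ≤ s * m → s * m < (w + t) * n + n → w ≡ bound s t
    rank<n⇒≡bound {w} {t} le lt = trans (sym (m+n∸n≡m w t)) (cong (_∸ t) (m*n≤o<m*n+n⇒m≡o/n le lt))

    bound-step : ∀ s t c → bound s t ≤ bound (suc c + s) (suc t)
    bound-step s t c = ∸-monoˡ-≤ (suc t) (m*n≤o⇒m≤o/n (+-mono-≤ (<⇒≤ n<m)
      (≤-trans (m/n*n≤m (s * m) n) (*-monoˡ-≤ m (m≤n+m s c)))))

    bounds-ascending : ∀ {s t cs} → All (0 <_) cs → Ascending (bound s t) (bounds s t cs)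
    bounds-ascending []                            = []
    bounds-ascending {s} {t} (z<s {c} ∷ positive) = ≤-refl ∷ asc-weaken (bound-step s t c) (bounds-ascending positive)

    -- The invariant of decodeFrom y t when the blocks written so far reach height s.
    record CodeFrom (y s t : ℕ) (cs ws : List ℕ) : Set where
      field
        positive : All (0 <_) cs
        under    : Fits y (bounds s t cs) ws
        t≤s      : t ≤ s
        height   : sum cs + s ≡ n
        y+t≤m    : y + t ≤ m

    Code : List ℕ → List ℕ → Set
    Code = CodeFrom 0 0 0

    module _ {y s t c w : ℕ} {cs ws : List ℕ} (code : CodeFrom y s t (c ∷ cs) (w ∷ ws)) where
      open CodeFrom code

      code-y≤w : y ≤ w
      code-y≤w with under
      ... | cons y≤w _ _ = y≤w

      code-below : (w + t) * n ≤ s * m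
      code-below with under
      ... | cons _ w≤b _ = ≤bound⇒above t≤s w≤b

      code-s<n : s < n
      code-s<n with positive
      ... | z<s {c′} ∷ _ = <-≤-trans (s≤s (m≤n+m s (c′ + sum cs))) (≤-reflexive height)

      code-inside : w + t < m
      code-inside = *-cancelʳ-< n (w + t) m (≤-<-trans code-below (s*m<m*n code-s<n))

      code-tail : CodeFrom w (c + s) (suc t) cs ws
      code-tail with positive | under
      ... | 1≤c ∷ positive′ | cons _ _ under′ = record
        { positive = positive′
        ; under    = under′
        ; t≤s      = +-mono-≤ 1≤c t≤s
        ; height   = trans (x∙yz≈yx∙z +-commutativeSemigroup (sum cs) c s) height
        ; y+t≤m    = subst (_≤ m) (sym (+-suc w t)) code-inside
        }

    #N-decode : ∀ {y s t cs ws} → Fits y (bounds s t cs) ws → #N (decodeFrom y t cs ws) ≡ sum cs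
    #N-decode {y} {t = t} {[]} {[]} [] = #N-east (m ∸ (y + t)) []
    #N-decode {y} {cs = c ∷ cs} {w ∷ ws} (cons _ _ f) =
      trans (#N-east (w ∸ y) _) (trans (#N-north c _) (cong (c +_) (#N-decode f)))

    #E-decode : ∀ {y s t cs ws} → CodeFrom y s t cs ws → #E (decodeFrom y t cs ws) + (y + t) ≡ m
    #E-decode {y} {t = t} {[]} {[]} code =
      trans (cong (_+ (y + t)) (trans (#E-east (m ∸ (y + t)) []) (+-identityʳ _))) (m∸n+n≡m (CodeFrom.y+t≤m code))
    #E-decode {y} {s} {t} {c ∷ cs} {w ∷ ws} code = begin
      #E (east (w ∸ y) (north c (E ∷ rest))) + (y + t)
        ≡⟨ cong (_+ (y + t)) (trans (#E-east (w ∸ y) _) (cong ((w ∸ y) +_) (#E-north c (E ∷ rest)))) ⟩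
      (w ∸ y) + suc (#E rest) + (y + t)
        ≡⟨ shuffle (w ∸ y) (#E rest) (y + t) ⟩
      #E rest + suc ((w ∸ y) + (y + t))
        ≡⟨ cong (λ x → #E rest + suc x) (∸-+-cancel t (code-y≤w code)) ⟩
      #E rest + suc (w + t)
        ≡⟨ cong (#E rest +_) (sym (+-suc w t)) ⟩
      #E rest + (w + suc t)
        ≡⟨ #E-decode (code-tail code) ⟩
      m ∎
      where
      open ≡-Reasoning
      rest : List Step
      rest = decodeFrom w (suc t) cs ws
      shuffle : ∀ k e x → k + suc e + x ≡ e + suc (k + x)
      shuffle = solve-∀

    above-decode : ∀ {y s t cs ws} → CodeFrom y s t cs ws → aboveFrom m n (y + t) s (decodeFrom y t cs ws)
    above-decode {y} {s} {t} {[]} {[]} code =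
      above-east (m ∸ (y + t)) [] (m∸n+n≡m (CodeFrom.y+t≤m code)) end end
      where
      end : m * n ≤ s * m
      end = ≤-reflexive (trans (*-comm m n) (cong (_* m) (sym (CodeFrom.height code))))
    above-decode {y} {s} {t} {c ∷ cs} {w ∷ ws} code =
      above-east (w ∸ y) _ (∸-+-cancel t (code-y≤w code)) (code-below code)
        (above-north c _ (code-below code)
          ( ≤-trans (code-below code) (*-monoˡ-≤ m (m≤n+m s c))
          , subst (λ x → aboveFrom m n x (c + s) (decodeFrom w (suc t) cs ws)) (+-suc w t) (above-decode (code-tail code))))

    return-iff-touch : ∀ {w t s B ws} → t ≤ s → (w + t) * n ≤ s * m →
                       (if s * m <ᵇ (w + t) * n + n then 1 else 0) + touches B ws ≡ touches (bound s t ∷ B) (w ∷ ws)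
    return-iff-touch {w} {t} {s} {B} {ws} t≤s below with w ≟ bound s t
    ... | yes w≡b = cong (λ b → (if b then 1 else 0) + touches B ws)
                         (dec-true (s * m <? (w + t) * n + n) (≡bound⇒rank<n t≤s w≡b))
    ... | no  w≢b = cong (λ b → (if b then 1 else 0) + touches B ws)
                         (dec-false (s * m <? (w + t) * n + n) (w≢b ∘ rank<n⇒≡bound {w} {t} {s} below))

    ret-decode : ∀ {y s t cs ws} → CodeFrom y s t cs ws →
                 retFrom m n (y + t) s (decodeFrom y t cs ws) ≡ touches (bounds s t cs) ws
    ret-decode {y} {s} {t} {[]} {[]} code = retFrom-east (m ∸ (y + t)) (y + t) s []
    ret-decode {cs = zero ∷ _} {_ ∷ _} code with CodeFrom.positive code
    ... | () ∷ _
    ret-decode {y} {s} {t} {suc c ∷ cs} {w ∷ ws} code = begin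
      retFrom m n (y + t) s (east (w ∸ y) (N ∷ north c (E ∷ rest)))
        ≡⟨ retFrom-east (w ∸ y) (y + t) s _ ⟩
      retFrom m n ((w ∸ y) + (y + t)) s (N ∷ north c (E ∷ rest))
        ≡⟨ cong (λ x → retFrom m n x s (N ∷ north c (E ∷ rest))) (∸-+-cancel t (code-y≤w code)) ⟩
      bit + retFrom m n (w + t) (suc s) (north c (E ∷ rest))
        ≡⟨ cong (bit +_) (retFrom-north c (w + t) (suc s) (E ∷ rest) higher) ⟩
      bit + retFrom m n (suc (w + t)) (c + suc s) rest
        ≡⟨ cong (bit +_) (subst₂ (λ x j → retFrom m n x j rest ≡ touches (bounds (suc c + s) (suc t) cs) ws)
                                  (+-suc w t) (sym (+-suc c s)) (ret-decode (code-tail code))) ⟩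
      bit + touches (bounds (suc c + s) (suc t) cs) ws
        ≡⟨ return-iff-touch {w} {t} {s} (CodeFrom.t≤s code) (code-below code) ⟩
      touches (bounds s t (suc c ∷ cs)) (w ∷ ws) ∎
      where
      open ≡-Reasoning
      rest : List Step
      rest = decodeFrom w (suc t) cs ws
      bit : ℕ
      bit = if s * m <ᵇ (w + t) * n + n then 1 else 0
      -- as m > n, only the first north step of a block can be a return
      higher : (w + t) * n + n < suc s * m
      higher = <-≤-trans (+-mono-≤-< (code-below code) n<m) (≤-reflexive (+-comm (s * m) m))

    coarea-decode : ∀ {y s t cs ws} → Fits y (bounds s t cs) ws →
                    coareaFrom (y + t) (decodeFrom y t cs ws) ≡ blockCoarea t cs ws
    coarea-decode {y} {t = t} {[]} {[]} [] = coarea-east (m ∸ (y + t)) (y + t) []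
    coarea-decode {y} {t = t} {c ∷ cs} {w ∷ ws} (cons y≤w _ f) = begin
      coareaFrom (y + t) (east (w ∸ y) (north c (E ∷ rest)))
        ≡⟨ coarea-east (w ∸ y) (y + t) _ ⟩
      coareaFrom ((w ∸ y) + (y + t)) (north c (E ∷ rest))
        ≡⟨ cong (λ x → coareaFrom x (north c (E ∷ rest))) (∸-+-cancel t y≤w) ⟩
      coareaFrom (w + t) (north c (E ∷ rest))
        ≡⟨ coarea-north c (w + t) (E ∷ rest) ⟩
      replicate c (w + t) ++ coareaFrom (suc (w + t)) rest
        ≡⟨ cong (λ x → replicate c (w + t) ++ coareaFrom x rest) (sym (+-suc w t)) ⟩
      replicate c (w + t) ++ coareaFrom (w + suc t) rest
        ≡⟨ cong (replicate c (w + t) ++_) (coarea-decode f) ⟩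
      blockCoarea t (c ∷ cs) (w ∷ ws) ∎
      where
      open ≡-Reasoning
      rest : List Step
      rest = decodeFrom w (suc t) cs ws

    comp-decode : ∀ {y s t cs ws} → All (0 <_) cs → Fits y (bounds s t cs) ws → compAux 0 (decodeFrom y t cs ws) ≡ cs
    comp-decode {y} {t = t} {[]} {[]} [] [] = comp-east (m ∸ (y + t)) []
    comp-decode {y} {t = t} {suc c ∷ cs} {w ∷ ws} (_ ∷ positive) (cons _ _ f) = begin
      compAux 0 (east (w ∸ y) (north (suc c) (E ∷ rest)))  ≡⟨ comp-east (w ∸ y) _ ⟩
      compAux 0 (north (suc c) (E ∷ rest))                 ≡⟨ comp-north (suc c) 0 (E ∷ rest) ⟩
      suc c ∷ compAux 0 rest                               ≡⟨ cong (suc c ∷_) (comp-decode positive f) ⟩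
      suc c ∷ cs ∎
      where
      open ≡-Reasoning
      rest : List Step
      rest = decodeFrom w (suc t) cs ws

    offsets-decode : ∀ {y s t cs ws} → All (0 <_) cs → Fits y (bounds s t cs) ws →
                     offsetsFrom t (y + t) 0 (decodeFrom y t cs ws) ≡ ws
    offsets-decode {y} {t = t} {[]} {[]} [] [] = offsets-east (m ∸ (y + t)) t (y + t) []
    offsets-decode {y} {t = t} {suc c ∷ cs} {w ∷ ws} (_ ∷ positive) (cons y≤w _ f) = begin
      offsetsFrom t (y + t) 0 (east (w ∸ y) (north (suc c) (E ∷ rest)))
        ≡⟨ offsets-east (w ∸ y) t (y + t) _ ⟩
      offsetsFrom t ((w ∸ y) + (y + t)) 0 (north (suc c) (E ∷ rest))
        ≡⟨ cong (λ x → offsetsFrom t x 0 (north (suc c) (E ∷ rest))) (∸-+-cancel t y≤w) ⟩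
      offsetsFrom t (w + t) 0 (north (suc c) (E ∷ rest))
        ≡⟨ offsets-north (suc c) t (w + t) 0 (E ∷ rest) ⟩
      w + t ∸ t ∷ offsetsFrom (suc t) (suc (w + t)) 0 rest
        ≡⟨ cong₂ _∷_ (m+n∸n≡m w t) (cong (λ x → offsetsFrom (suc t) x 0 rest) (sym (+-suc w t))) ⟩
      w ∷ offsetsFrom (suc t) (w + suc t) 0 rest
        ≡⟨ cong (w ∷_) (offsets-decode positive f) ⟩
      w ∷ ws ∎
      where
      open ≡-Reasoning
      rest : List Step
      rest = decodeFrom w (suc t) cs ws

    blockCoarea-∋ : ∀ {y s t cs ws j} → All (0 <_) cs → Fits y (bounds s t cs) ws → t ≤ j → j < t + zeros ws →
                    memℕ j (blockCoarea t cs ws) ≡ true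
    blockCoarea-∋ {t = t} {[]} {[]} _ _ t≤j j<t+0 =
      contradiction (≤-trans (≤-reflexive (+-identityʳ t)) t≤j) (<⇒≱ j<t+0)
    blockCoarea-∋ {t = t} {_ ∷ _} {suc _ ∷ _} _ _ t≤j j<t+0 =
      contradiction (≤-trans (≤-reflexive (+-identityʳ t)) t≤j) (<⇒≱ j<t+0)
    blockCoarea-∋ {cs = zero ∷ _} {zero ∷ _} (() ∷ _) _ _ _
    blockCoarea-∋ {t = t} {suc c ∷ cs} {zero ∷ ws} {j} (_ ∷ positive) (cons _ _ f) t≤j j<t+z with j ≟ t
    ... | yes refl = memℕ-replicate-≡ c j _
    ... | no  j≢t  = trans (memℕ-replicate-≢ (suc c) _ j≢t)
                           (blockCoarea-∋ positive f (≤∧≢⇒< t≤j (j≢t ∘ sym))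
                              (<-≤-trans j<t+z (≤-reflexive (+-suc t (zeros ws)))))

    blockCoarea-∌ : ∀ {lo s t cs ws j} → Fits lo (bounds s t cs) ws → j < lo + t →
                    memℕ j (blockCoarea t cs ws) ≡ false
    blockCoarea-∌ {cs = []} {[]} [] _ = refl
    blockCoarea-∌ {t = t} {c ∷ cs} {w ∷ ws} {j} (cons lo≤w _ f) j<lo+t =
      trans (memℕ-replicate-≢ c _ (<⇒≢ j<w+t))
            (blockCoarea-∌ f (<-≤-trans j<w+t (≤-trans (n≤1+n _) (≤-reflexive (sym (+-suc w t))))))
      where j<w+t = <-≤-trans j<lo+t (+-monoˡ-≤ t lo≤w)

    blockCoarea-first-∌ : ∀ {y s t cs ws} → Fits y (bounds s t cs) ws →
                          memℕ (t + zeros ws) (blockCoarea t cs ws) ≡ false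
    blockCoarea-first-∌ {cs = []} {[]} [] = refl
    blockCoarea-first-∌ {t = t} {c ∷ cs} {zero ∷ ws} (cons _ _ f) =
      trans (memℕ-replicate-≢ c _ (m+1+n≢m t))
            (subst (λ j → memℕ j (blockCoarea (suc t) cs ws) ≡ false) (sym (+-suc t (zeros ws))) (blockCoarea-first-∌ f))
    blockCoarea-first-∌ {s = s} {t} {c ∷ cs} {suc w ∷ ws} (cons _ w≤b f) =
      blockCoarea-∌ {s = s} {cs = c ∷ cs} (cons ≤-refl w≤b f)
        (s≤s (≤-trans (≤-reflexive (+-identityʳ t)) (m≤n+m t w)))

    code-1≤zeros : ∀ {cs ws} → Code cs ws → 1 ≤ zeros ws
    code-1≤zeros {[]}    code = contradiction (sym (CodeFrom.height code)) (≢-nonZero⁻¹ n)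
    code-1≤zeros {_ ∷ _} {x ∷ _} code with CodeFrom.under code
    ... | cons _ x≤0/n _ with n≤0⇒n≡0 (subst (x ≤_) (0/n≡0 n) x≤0/n)
    ...   | refl = s≤s z≤n

    code-zeros≤n : ∀ {cs ws} → Code cs ws → zeros ws ≤ n
    code-zeros≤n {cs} {ws} code = begin
      zeros ws                ≤⟨ zeros≤length under ⟩
      length (bounds 0 0 cs)  ≡⟨ length-bounds 0 0 cs ⟩
      length cs               ≤⟨ length≤sum positive ⟩
      sum cs                  ≡⟨ trans (sym (+-identityʳ _)) height ⟩
      n                       ∎
      where
      open ≤-Reasoning
      open CodeFrom code

    run-decode : ∀ {cs ws} → Code cs ws → run (decode cs ws) ≡ zeros ws
    run-decode {cs} {ws} code = begin
      firstMissing 1 (#N (decode cs ws) ∸ 1) (coareaFrom 0 (decode cs ws))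
        ≡⟨ cong₂ (λ k us → firstMissing 1 (k ∸ 1) us) (trans (#N-decode under) (trans (sym (+-identityʳ _)) height))
                                                      (coarea-decode under) ⟩
      firstMissing 1 (n ∸ 1) (blockCoarea 0 cs ws)
        ≡⟨ firstMissing-≡ (n ∸ 1) (code-1≤zeros code)
                          (≤-trans (code-zeros≤n code) (≤-reflexive (sym (m+[n∸m]≡n (>-nonZero⁻¹ n)))))
                          (λ _ → blockCoarea-∋ positive under z≤n) (blockCoarea-first-∌ under) ⟩
      zeros ws ∎
      where
      open ≡-Reasoning
      open CodeFrom code

    fits-block : ∀ {y t x} s {A ws} → y + t ≤ x → x * n ≤ s * m → Fits (x ∸ t) A ws →
                 Fits y (bound s t ∷ A) (x ∸ t ∷ ws)
    fits-block {y} {t} {x} s y+t≤x bottom =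
      cons (m+n≤o⇒m≤o∸n y y+t≤x)
           (above⇒≤bound {s = s} (subst (λ x′ → x′ * n ≤ s * m) (sym (m∸n+n≡m (m+n≤o⇒n≤o y y+t≤x))) bottom))

    offsets-fits : ∀ p {t x c} s {y} → x * n ≤ s * m → aboveFrom m n x (c + s) p → t ≤ s → y + t ≤ x →
                   Fits y (bounds s t (compAux c p)) (offsetsFrom t x c p)
    offsets-fits []      {c = zero}  s _      _  _   _     = []
    offsets-fits []      {c = suc c} s bottom _  _   y+t≤x = fits-block s y+t≤x bottom []
    offsets-fits (N ∷ p) {c = zero}  s bottom (_ , ab) t≤s y+t≤x = offsets-fits p s bottom ab t≤s y+t≤x
    offsets-fits (N ∷ p) {c = suc c} s bottom (_ , ab) t≤s y+t≤x = offsets-fits p s bottom ab t≤s y+t≤x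
    offsets-fits (E ∷ p) {c = zero}  s _      (_ , ab) t≤s y+t≤x =
      offsets-fits p s (aboveFrom-head p ab) ab t≤s (m≤n⇒m≤1+n y+t≤x)
    offsets-fits (E ∷ p) {t} {x} {suc c} s {y} bottom (_ , ab) t≤s y+t≤x =
      fits-block s y+t≤x bottom
        (offsets-fits p (suc c + s) (aboveFrom-head p ab) ab (s≤s (≤-trans t≤s (m≤n+m s c)))
           (≤-reflexive (trans (+-suc (x ∸ t) t) (cong suc (m∸n+n≡m (m+n≤o⇒n≤o y y+t≤x))))))

    decode-offsets : ∀ p {t x c} s {y} → y + t ≤ x → #E p + x ≡ m → c + s + #N p ≡ n → x * n ≤ s * m →
                     aboveFrom m n x (c + s) p →
                     decodeFrom y t (compAux c p) (offsetsFrom t x c p) ≡ east (x ∸ (y + t)) (north c p)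
    decode-offsets [] {t} {c = zero} s {y} _ x≡m _ _ _ = cong (λ x → east (x ∸ (y + t)) []) (sym x≡m)
    decode-offsets [] {c = suc c} s _ x≡m height bottom _ =
      -- the last block would start at (m, s) with s < n, below the line
      contradiction (subst (λ x → x * n ≤ s * m) x≡m bottom) (<⇒≱ (s*m<m*n s<n))
      where
      s<n : s < n
      s<n = <-≤-trans (s≤s (m≤n+m s c)) (≤-reflexive (trans (sym (+-identityʳ _)) height))
    decode-offsets (N ∷ p) {c = zero} s y+t≤x x-count height bottom (_ , ab) =
      decode-offsets p s y+t≤x x-count (trans (sym (+-suc s (#N p))) height) bottom ab
    decode-offsets (N ∷ p) {t} {x} {suc c} s {y} y+t≤x x-count height bottom (_ , ab) =
      trans (decode-offsets p s y+t≤x x-count (trans (sym (+-suc (suc c + s) (#N p))) height) bottom ab)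
            (cong (east (x ∸ (y + t))) (north-suc (suc c) p))
    decode-offsets (E ∷ p) {t} {x} {zero} s {y} y+t≤x x-count height _ (_ , ab) =
      trans (decode-offsets p s (m≤n⇒m≤1+n y+t≤x) (trans (+-suc (#E p) x) x-count) height (aboveFrom-head p ab) ab)
            (trans (cong (λ g → east g p) (+-∸-assoc 1 y+t≤x)) (east-suc (x ∸ (y + t)) p))
    decode-offsets (E ∷ p) {t} {x} {suc c} s {y} y+t≤x x-count height _ (_ , ab) =
      cong₂ (λ g q → east g (north (suc c) (E ∷ q)))
            (trans (∸-+-assoc x t y) (cong (x ∸_) (+-comm t y)))
            (trans (decode-offsets p {suc t} {suc x} {0} (suc c + s) {x ∸ t} (≤-reflexive next)
                      (trans (+-suc (#E p) x) x-count) height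
                      (aboveFrom-head p ab) ab)
                   (trans (cong (λ x′ → east (suc x ∸ x′) p) next) (cong (λ g → east g p) (n∸n≡0 (suc x)))))
      where
      next : x ∸ t + suc t ≡ suc x
      next = trans (+-suc (x ∸ t) t) (cong suc (m∸n+n≡m (m+n≤o⇒n≤o y y+t≤x)))

    encode-valid : ∀ {p} → IsDyck m n p → Code (comp p) (offsets p)
    encode-valid {p} (_ , #N≡n , ab) = record
      { positive = compAux-positive 0 p
      ; under    = offsets-fits p 0 z≤n ab z≤n z≤n
      ; t≤s      = z≤n
      ; height   = trans (+-identityʳ _) (trans (sum-compAux 0 p) #N≡n)
      ; y+t≤m    = z≤n
      }

    decode-encode : ∀ {p} → IsDyck m n p → decode (comp p) (offsets p) ≡ p
    decode-encode {p} (#E≡m , #N≡n , ab) = decode-offsets p 0 z≤n (trans (+-identityʳ _) #E≡m) #N≡n z≤n ab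

    decode-dyck : ∀ {cs ws} → Code cs ws → IsDyck m n (decode cs ws)
    decode-dyck code =
        trans (sym (+-identityʳ _)) (#E-decode code)
      , trans (#N-decode under) (trans (sym (+-identityʳ _)) height)
      , above-decode code
      where open CodeFrom code

    code-ascending : ∀ {cs ws} → Code cs ws → Ascending 0 (bounds 0 0 cs)
    code-ascending code = asc-weaken z≤n (bounds-ascending (CodeFrom.positive code))

    φ-valid : ∀ {cs ws} → Code cs ws → Code cs (φ (bounds 0 0 cs) ws)
    φ-valid code = record
      { positive = positive
      ; under    = Exchanges.fits (φ-exchanges (code-ascending code) under)
      ; t≤s      = t≤s
      ; height   = height
      ; y+t≤m    = y+t≤m
      }
      where open CodeFrom code

    Φ-path : List Step → List Step
    Φ-path p = decode (comp p) (φ (bounds 0 0 (comp p)) (offsets p))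

    Φ : Dyck m n → Dyck m n
    Φ (p , dyck) = Φ-path p , decode-dyck (φ-valid (encode-valid dyck))

    Φ-path-decode : ∀ {cs ws} → Code cs ws → Φ-path (decode cs ws) ≡ decode cs (φ (bounds 0 0 cs) ws)
    Φ-path-decode code =
      cong₂ (λ cs′ ws′ → decode cs′ (φ (bounds 0 0 cs′) ws′)) (comp-decode positive under) (offsets-decode positive under)
      where open CodeFrom code

    module _ (P : Dyck m n) where
      private
        p : List Step
        p = proj₁ P
        dyck : IsDyck m n p
        dyck = proj₂ P
        cs : List ℕ
        cs = comp p
        ws : List ℕ
        ws = offsets p
        A : List ℕ
        A = bounds 0 0 cs
        code : Code cs ws
        code = encode-valid dyck
        code′ : Code cs (φ A ws)
        code′ = φ-valid code
        open Exchanges (φ-exchanges (code-ascending code) (CodeFrom.under code))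
        open ≡-Reasoning

      Φ-involutive : proj₁ (Φ (Φ P)) ≡ p
      Φ-involutive = begin
        Φ-path (decode cs (φ A ws))  ≡⟨ Φ-path-decode code′ ⟩
        decode cs (φ A (φ A ws))     ≡⟨ cong (decode cs) (φ-involutive (code-ascending code) (CodeFrom.under code)) ⟩
        decode cs ws                 ≡⟨ decode-encode dyck ⟩
        p                            ∎

      Φ-comp : comp (proj₁ (Φ P)) ≡ comp p
      Φ-comp = comp-decode (CodeFrom.positive code′) (CodeFrom.under code′)

      Φ-run : run (proj₁ (Φ P)) ≡ ret m n p
      Φ-run = begin
        run (decode cs (φ A ws))  ≡⟨ run-decode code′ ⟩
        zeros (φ A ws)            ≡⟨ zeros≡touches ⟩
        touches A ws              ≡⟨ ret-decode code ⟨
        ret m n (decode cs ws)    ≡⟨ cong (ret m n) (decode-encode dyck) ⟩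
        ret m n p                 ∎

      Φ-ret : ret m n (proj₁ (Φ P)) ≡ run p
      Φ-ret = begin
        ret m n (decode cs (φ A ws))  ≡⟨ ret-decode code′ ⟩
        touches A (φ A ws)            ≡⟨ touches≡zeros ⟩
        zeros ws                      ≡⟨ run-decode code ⟨
        run (decode cs ws)            ≡⟨ cong run (decode-encode dyck) ⟩
        run p                         ∎

theorem3p1 : (m n : ℕ) → 0 < n → n < m →
    Σ (Dyck m n → Dyck m n) λ Φ → (P : Dyck m n) →
      (proj₁ (Φ (Φ P)) ≡ proj₁ P)
      × (comp (proj₁ (Φ P)) ≡ comp (proj₁ P))
      × (run (proj₁ (Φ P)) ≡ ret m n (proj₁ P))
      × (ret m n (proj₁ (Φ P)) ≡ run (proj₁ P))
theorem3p1 m n 0<n n<m = Φ , λ P → Φ-involutive P , Φ-comp P , Φ-run P , Φ-ret P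
  where open Coding m n {{>-nonZero 0<n}} n<m
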